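{- Let $G=(V,E)$ be a graph with neighborhood decomposition $V=\bigsqcup_{i\in[r]}T_i$ (of minimum size $r$), let $\mathcal{C}:V\to[c]$ be a coloring, and let $S$ be a minimum consistent subset for $(G,\mathcal{C})$. Let $\mathcal{T}_1=\{T_i: |\mathcal{C}(T_i\cap S)|=1\}$ and $\mathcal{T}_2=\{T_i: |\mathcal{C}(T_i\cap S)|>1\}$. Let $R\subseteq[c]$ be an inclusion-wise minimal set of colors such that (i) for each $T_i\in\mathcal{T}_1$, $R$ contains the unique color in $\mathcal{C}(T_i\cap S)$, and (ii) for each $T_i\in\mathcal{T}_2$, $R$ contains at least two distinct colors from $\mathcal{C}(T_i\cap S)$. Then for every vertex $v\in V$, $$d\bigl(v,\; S\setminus \mathcal{C}^{ -1}(\mathcal{C}(v))\bigr)=d\Bigl(v,\; S\cap \bigcup_{j\in R\setminus\{\mathcal{C}(v)\}}\mathcal{C}^{ -1}(j)\Bigr).$$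
   Context: Distances $d(u,v)$ are shortest-path distances in $G$; for $U\subseteq V$, $d(v,U)=\min_{u\in U}d(v,u)$ and $\mathrm{NN}(v,U)=\{u\in U:d(v,u)=d(v,U)\}$. A set $S\subseteq V$ is a consistent subset for $(G,\mathcal{C})$ if for every $v\in V$, $\mathcal{C}(v)\in\mathcal{C}(\mathrm{NN}(v,S))$; a minimum consistent subset is one of minimum cardinality. Two vertices $u,v$ are of the same type if $N(v)\setminus\{u\}=N(u)\setminus\{v\}$. A neighborhood decomposition is a partition of $V$ into classes of pairwise same-type vertices. A set $R$ as in the statement is called a set of responsible colors for $S$. -}

module Defs where

open import Data.Nat using (ℕ; zero; suc; _≤_; _>_)
open import Data.Fin using (Fin; _≟_)
open import Data.Fin.Properties using (any?)
open import Data.Fin.Subset using (Subset; _∈_; _∉_; _⊆_; _⊂_; ⁅_⁆; ∣_∣)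
open import Data.Fin.Subset.Properties using (_∈?_)
open import Data.Vec using (tabulate; lookup)
open import Data.Maybe using (Maybe; just; nothing)
open import Data.Product using (Σ; ∃; _×_; _,_)
open import Relation.Nullary using (¬_; does)
open import Relation.Nullary.Decidable using (_×-dec_)
open import Relation.Binary using (Decidable; Symmetric; Irreflexive)
open import Relation.Binary.PropositionalEquality using (_≡_; _≢_)
open import Function.Bundles using (_⇔_)

record Graph (n : ℕ) : Set₁ where
  field
    Adj     : Fin n → Fin n → Set
    adj?    : Decidable Adj
    adjSym  : Symmetric Adj
    adjIrr  : Irreflexive _≡_ Adj
open Graph public

module _ {n : ℕ} (G : Graph n) where

  data Walk : Fin n → Fin n → ℕ → Set where
    here : ∀ {u} → Walk u u zero
    step : ∀ {u x w k} → Adj G u x → Walk x w k → Walk u w (suc k)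

  -- DistTo v U x : the shortest-path distance d(v,U) = min_{u∈U} d(v,u) equals x,
  -- where nothing stands for ∞ (no vertex of U reachable from v, in particular U = ∅).
  DistTo : Fin n → Subset n → Maybe ℕ → Set
  DistTo v U (just k) =
    (∃ λ u → u ∈ U × Walk v u k) × (∀ u m → u ∈ U → Walk v u m → k ≤ m)
  DistTo v U nothing = ∀ u m → u ∈ U → ¬ Walk v u m

  InNN : Fin n → Subset n → Fin n → Set
  InNN v S u = u ∈ S × (∃ λ x → DistTo v ⁅ u ⁆ x × DistTo v S x)

  module _ {c : ℕ} (C : Fin n → Fin c) where

    Consistent : Subset n → Set
    Consistent S = ∀ v → ∃ λ u → InNN v S u × C u ≡ C v

    MinConsistent : Subset n → Set
    MinConsistent S = Consistent S × (∀ S′ → Consistent S′ → ∣ S ∣ ≤ ∣ S′ ∣)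

  SameType : Fin n → Fin n → Set
  SameType u v = ∀ w → (Adj G v w × w ≢ u) ⇔ (Adj G u w × w ≢ v)

  -- A neighborhood decomposition into r classes T_i = t⁻¹(i): every class nonempty
  -- (so it is a partition) and vertices in the same class are of the same type.
  IsNbDecomp : (r : ℕ) → (Fin n → Fin r) → Set
  IsNbDecomp r t = (∀ i → ∃ λ u → t u ≡ i) × (∀ u v → t u ≡ t v → SameType u v)

  IsMinNbDecomp : (r : ℕ) → (Fin n → Fin r) → Set
  IsMinNbDecomp r t =
    IsNbDecomp r t × (∀ r′ (t′ : Fin n → Fin r′) → IsNbDecomp r′ t′ → r ≤ r′)

image : ∀ {n m} → (Fin n → Fin m) → Subset n → Subset m
image {n} f A = tabulate λ j → does (any? λ u → (u ∈? A) ×-dec (f u ≟ j))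

preimage : ∀ {n m} → (Fin n → Fin m) → Subset m → Subset n
preimage f X = tabulate λ u → lookup X (f u)

classOf : ∀ {n r} → (Fin n → Fin r) → Fin r → Subset n
classOf t i = preimage t ⁅ i ⁆

module _ {n r c : ℕ} (t : Fin n → Fin r) (C : Fin n → Fin c) (S : Subset n) where
  open import Data.Fin.Subset using (_∩_)

  colsOf : Fin r → Subset c
  colsOf i = image C (classOf t i ∩ S)

  Responsible : Subset c → Set
  Responsible R =
    (∀ i → ∣ colsOf i ∣ ≡ 1 → ∀ j → j ∈ colsOf i → j ∈ R) ×
    (∀ i → ∣ colsOf i ∣ > 1 →
       Σ (Fin c) λ j₁ → Σ (Fin c) λ j₂ →
         j₁ ≢ j₂ × j₁ ∈ colsOf i × j₂ ∈ colsOf i × j₁ ∈ R × j₂ ∈ R)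

  MinResponsible : Subset c → Set
  MinResponsible R = Responsible R × (∀ R′ → R′ ⊂ R → ¬ Responsible R′)

-- A vertex u of S whose colour differs from C(v) lies in a class T_i, and the
-- responsible colours R meet C(T_i ∩ S) in some colour other than C(v); pick a
-- vertex w ∈ T_i ∩ S of that colour. Since u and w are of the same type and v is
-- neither of them, every walk from v to u yields a walk from v to w that is no
-- longer. Hence the subset S ∩ C⁻¹(R ∖ {C(v)}) of S ∖ C⁻¹(C(v)) is at the same
-- distance from v.
module Submission where

open import Defs
open import Data.Nat using (ℕ; suc; _≤_; z≤n; s≤s)
open import Data.Nat.Properties using (≤-trans; ≤-antisym; m≤n⇒m<n∨m≡n)
open import Data.Fin using (Fin; _≟_)
open import Data.Fin.Properties using (any?)
open import Data.Fin.Subset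
  using (Subset; _∩_; _─_; ∁; ⁅_⁆; _∈_; _∉_; _⊆_; ∣_∣; inside; outside)
open import Data.Fin.Subset.Properties
  using ( _∈?_; x∈p∩q⁺; x∈p∩q⁻; x∈∁p⇒x∉p; x∉p⇒x∈∁p; x∈⁅x⁆; x∈⁅y⁆⇒x≡y
        ; x∈p∧x∉q⇒x∈p─q; ∣⁅x⁆∣≡1; p⊆q⇒∣p∣≤∣q∣)
open import Data.Vec using (_∷_; here; there)
open import Data.Vec.Properties using (lookup∘tabulate; []=⇒lookup; lookup⇒[]=)
open import Data.Maybe using (Maybe; just; nothing)
open import Data.Product using (∃; _×_; _,_; proj₁)
open import Data.Sum using (inj₁; inj₂)
open import Data.Bool using (true)
open import Relation.Nullary using (Dec; yes; no; does; contradiction)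
open import Relation.Nullary.Decidable using (_×-dec_; dec-true)
open import Relation.Binary.PropositionalEquality
  using (_≡_; _≢_; refl; sym; trans; subst; cong)
open import Function using (_∘′_)
open import Function.Bundles using (_⇔_; mk⇔; Equivalence)

does-true⇒ : ∀ {p} {P : Set p} (d : Dec P) → does d ≡ true → P
does-true⇒ (yes p) _ = p

x∈p─q⇒x∉q : ∀ {n} {p q : Subset n} {x} → x ∈ p ─ q → x ∉ q
x∈p─q⇒x∉q {p = inside  ∷ _} {inside ∷ _} ()         here
x∈p─q⇒x∉q {p = outside ∷ _} {inside ∷ _} ()         here
x∈p─q⇒x∉q {p = _       ∷ _} {_      ∷ _} (there x∈) (there x∈q) = x∈p─q⇒x∉q x∈ x∈q

x∈p⇒1≤∣p∣ : ∀ {n} {p : Subset n} {x} → x ∈ p → 1 ≤ ∣ p ∣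
x∈p⇒1≤∣p∣ {p = p} {x} x∈p = subst (_≤ ∣ p ∣) (∣⁅x⁆∣≡1 x)
  (p⊆q⇒∣p∣≤∣q∣ λ y∈⁅x⁆ → subst (_∈ p) (sym (x∈⁅y⁆⇒x≡y _ y∈⁅x⁆)) x∈p)

∩-monoʳ-⊆ : ∀ {n} (p : Subset n) {q r} → q ⊆ r → p ∩ q ⊆ p ∩ r
∩-monoʳ-⊆ p q⊆r x∈p∩q with x∈p∩q⁻ p _ x∈p∩q
... | x∈p , x∈q = x∈p∩q⁺ (x∈p , q⊆r x∈q)

module _ {n m : ℕ} (f : Fin n → Fin m) where

  ∈-preimage⁺ : ∀ {X u} → f u ∈ X → u ∈ preimage f X
  ∈-preimage⁺ {X} {u} fu∈X =
    lookup⇒[]= u _ (trans (lookup∘tabulate _ u) ([]=⇒lookup fu∈X))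

  ∈-preimage⁻ : ∀ {X u} → u ∈ preimage f X → f u ∈ X
  ∈-preimage⁻ {X} {u} u∈ =
    lookup⇒[]= (f u) X (trans (sym (lookup∘tabulate _ u)) ([]=⇒lookup u∈))

  ∈-image⁺ : ∀ {A u} → u ∈ A → f u ∈ image f A
  ∈-image⁺ {A} {u} u∈A = lookup⇒[]= (f u) _ (trans (lookup∘tabulate _ (f u))
    (dec-true (any? λ w → (w ∈? A) ×-dec (f w ≟ f u)) (u , u∈A , refl)))

  ∈-image⁻ : ∀ {A j} → j ∈ image f A → ∃ λ u → u ∈ A × f u ≡ j
  ∈-image⁻ {A} {j} j∈ = does-true⇒ (any? λ u → (u ∈? A) ×-dec (f u ≟ j))
    (trans (sym (lookup∘tabulate _ j)) ([]=⇒lookup j∈))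

module _ {n c : ℕ} (C : Fin n → Fin c) (a : Fin c) where

  ∈-∁-preimage-⁅⁆⁻ : ∀ {u} → u ∈ ∁ (preimage C ⁅ a ⁆) → C u ≢ a
  ∈-∁-preimage-⁅⁆⁻ u∈ Cu≡a =
    x∈∁p⇒x∉p u∈ (∈-preimage⁺ C (subst (_∈ ⁅ a ⁆) (sym Cu≡a) (x∈⁅x⁆ a)))

  ∈-preimage-─⁅⁆⁺ : ∀ {R w} → C w ∈ R → C w ≢ a → w ∈ preimage C (R ─ ⁅ a ⁆)
  ∈-preimage-─⁅⁆⁺ Cw∈R Cw≢a =
    ∈-preimage⁺ C (x∈p∧x∉q⇒x∈p─q Cw∈R (Cw≢a ∘′ x∈⁅y⁆⇒x≡y _))

  preimage-─⁅⁆⊆∁-preimage-⁅⁆ : ∀ R → preimage C (R ─ ⁅ a ⁆) ⊆ ∁ (preimage C ⁅ a ⁆)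
  preimage-─⁅⁆⊆∁-preimage-⁅⁆ R u∈ = x∉p⇒x∈∁p λ u∈C⁻¹a →
    x∈p─q⇒x∉q {p = R} (∈-preimage⁻ C u∈) (∈-preimage⁻ C u∈C⁻¹a)

module _ {n : ℕ} (G : Graph n) where

  walk-to-sameType : ∀ {u w v k} → SameType G u w → v ≢ u → v ≢ w →
                     Walk G v u k → ∃ λ k′ → k′ ≤ k × Walk G v w k′
  walk-to-sameType st v≢u v≢w here = contradiction refl v≢u
  walk-to-sameType {u} {w} {v} st v≢u v≢w (step {x = x} v~x x⇝u) with x ≟ w | x ≟ u
  ... | yes refl | _        = 1 , s≤s z≤n , step v~x here
  -- v ∈ N(u) ∖ {w} = N(w) ∖ {u}
  ... | no _     | yes refl =
    1 , s≤s z≤n , step (adjSym G (proj₁ (Equivalence.from (st v) (adjSym G v~x , v≢w)))) here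
  ... | no x≢w   | no x≢u   with walk-to-sameType st x≢u x≢w x⇝u
  ...   | k′ , k′≤k , x⇝w = suc k′ , s≤s k′≤k , step v~x x⇝w

  Dominates : Fin n → Subset n → Subset n → Set
  Dominates v B A =
    ∀ {u k} → u ∈ A → Walk G v u k → ∃ λ w → w ∈ B × ∃ λ k′ → k′ ≤ k × Walk G v w k′

  DistTo-⇔-dominating-subset : ∀ {v A B} → B ⊆ A → Dominates v B A →
                               ∀ x → DistTo G v A x ⇔ DistTo G v B x
  DistTo-⇔-dominating-subset {v} {A} {B} B⊆A dom (just k) = mk⇔ to from
    where
    to : DistTo G v A (just k) → DistTo G v B (just k)
    to ((u , u∈A , v⇝u) , least) with dom u∈A v⇝u
    ... | w , w∈B , k′ , k′≤k , v⇝w =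
      (w , w∈B , subst (Walk G v w) (≤-antisym k′≤k (least w k′ (B⊆A w∈B) v⇝w)) v⇝w) ,
      λ u m u∈B → least u m (B⊆A u∈B)
    from : DistTo G v B (just k) → DistTo G v A (just k)
    from ((u , u∈B , v⇝u) , least) = (u , B⊆A u∈B , v⇝u) , λ u m u∈A v⇝u →
      let w , w∈B , k′ , k′≤m , v⇝w = dom u∈A v⇝u in ≤-trans (least w k′ w∈B v⇝w) k′≤m
  DistTo-⇔-dominating-subset B⊆A dom nothing = mk⇔
    (λ unreachable u m u∈B → unreachable u m (B⊆A u∈B))
    (λ unreachable u m u∈A v⇝u →
      let w , w∈B , k′ , _ , v⇝w = dom u∈A v⇝u in unreachable w k′ w∈B v⇝w)

module _ {n r c : ℕ} (t : Fin n → Fin r) (C : Fin n → Fin c) (S : Subset n) where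

  responsible-avoids : ∀ {R} → Responsible t C S R → ∀ i {k a} →
                       k ∈ colsOf t C S i → k ≢ a →
                       ∃ λ j → j ∈ colsOf t C S i × j ∈ R × j ≢ a
  responsible-avoids (single , several) i {k} {a} k∈ k≢a
    with m≤n⇒m<n∨m≡n (x∈p⇒1≤∣p∣ k∈)
  ... | inj₂ one = k , k∈ , single i (sym one) k k∈ , k≢a
  ... | inj₁ many with several i many
  ...   | j₁ , j₂ , j₁≢j₂ , j₁∈ , j₂∈ , j₁∈R , j₂∈R with j₁ ≟ a
  ...     | no j₁≢a  = j₁ , j₁∈ , j₁∈R , j₁≢a
  ...     | yes refl = j₂ , j₂∈ , j₂∈R , λ j₂≡j₁ → j₁≢j₂ (sym j₂≡j₁)

  ∈-colsOf⁺ : ∀ {u} → u ∈ S → C u ∈ colsOf t C S (t u)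
  ∈-colsOf⁺ u∈S = ∈-image⁺ C (x∈p∩q⁺ (∈-preimage⁺ t (x∈⁅x⁆ _) , u∈S))

  ∈-colsOf⁻ : ∀ {i j} → j ∈ colsOf t C S i → ∃ λ w → t w ≡ i × w ∈ S × C w ≡ j
  ∈-colsOf⁻ {i} j∈ with ∈-image⁻ C j∈
  ... | w , w∈ , refl with x∈p∩q⁻ (classOf t i) S w∈
  ...   | w∈Tᵢ , w∈S = w , x∈⁅y⁆⇒x≡y i (∈-preimage⁻ t w∈Tᵢ) , w∈S , refl

mainTheorem4 : ∀ {n r c : ℕ} (G : Graph n) (t : Fin n → Fin r) (C : Fin n → Fin c)
    (S : Subset n) (R : Subset c) →
    IsMinNbDecomp G r t →
    MinConsistent G C S →
    MinResponsible t C S R →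
    ∀ v (x : Maybe ℕ) →
    DistTo G v (S ∩ ∁ (preimage C ⁅ C v ⁆)) x
    ⇔ DistTo G v (S ∩ preimage C (R ─ ⁅ C v ⁆)) x
mainTheorem4 G t C S R ((_ , sameType) , _) _ (responsible , _) v =
  DistTo-⇔-dominating-subset G
    (∩-monoʳ-⊆ S (preimage-─⁅⁆⊆∁-preimage-⁅⁆ C (C v) R)) dominates
  where
  dominates : Dominates G v (S ∩ preimage C (R ─ ⁅ C v ⁆)) (S ∩ ∁ (preimage C ⁅ C v ⁆))
  dominates {u} u∈ v⇝u with x∈p∩q⁻ S _ u∈
  ... | u∈S , u∈other with ∈-∁-preimage-⁅⁆⁻ C (C v) u∈other
  ...   | Cu≢Cv with responsible-avoids t C S responsible (t u) (∈-colsOf⁺ t C S u∈S) Cu≢Cv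
  ...     | j , j∈ , j∈R , j≢Cv with ∈-colsOf⁻ t C S j∈
  ...       | w , tw≡tu , w∈S , refl =
    w , x∈p∩q⁺ (w∈S , ∈-preimage-─⁅⁆⁺ C (C v) j∈R j≢Cv) ,
    walk-to-sameType G (sameType _ w (sym tw≡tu))
      (λ v≡u → Cu≢Cv (cong C (sym v≡u))) (λ v≡w → j≢Cv (cong C (sym v≡w))) v⇝u
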